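{- Let $D_0$ be a diagram and $(r,c)\in D_0$. Let $\Gamma(D_0)=\{D_0\succ D_1\succ\cdots\succ D_N\}$ be the Kohnert chain obtained by, at each step, applying the Kohnert move at the minimal row $r_{D_i}$ of $D_i$ at which a nontrivial Kohnert move can be applied, stopping when $D_N\in\mathrm{Min}(D_0)$. Let $\mathrm{R}_{\Gamma(D_0)}(D_0,r,c)$ be the set of rows $s$ such that, for some $j\in[N]$, $D_j$ is obtained from $D_{j-1}$ by the Kohnert move at row $s$ and this move moves the standard $r$-cell in column $c$ of $D_{j-1}$. Then $|\mathrm{R}_{\Gamma(D_0)}(D_0,r,c)|=\mathrm{room}_{D_0}(r,c)$.
   Context: A diagram is a finite subset $D\subset\mathbb{Z}_{>0}\times\mathbb{Z}_{>0}$; $(r,c)\in D$ is a cell in row $r$, column $c$. Kohnert move at row $r$: if row $r$ is empty, $\mathcal{K}(D,r)=D$; otherwise let $(r,c)$ be the rightmost cell of row $r$; if some $r'<r$ has $(r',c)\notin D$, take the largest such $r'$ and set $\mathcal{K}(D,r)=(D\setminus\{(r,c)\})\cup\{(r',c)\}$; else $\mathcal{K}(D,r)=D$. The move is nontrivial if $\mathcal{K}(D,r)\neq D$. $\mathrm{Min}(D_0)$ is the set of diagrams obtainable from $D_0$ by Kohnert moves that are fixed by all Kohnert moves. Kohnert moves preserve the number of cells in each column. For a diagram $D$ obtainable from $D_0$ and $(r,c)\in D_0$, if $(r,c)$ is the $k$-th lowest cell of column $c$ in $D_0$, the standard $r$-cell in column $c$ of $D$ is the $k$-th lowest cell of column $c$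 in $D$. For a diagram $D$, $(r,c)\in D$, $\tilde c>0$: $\mathrm{blockers}_{D,\tilde c}(r,c)=\{(\tilde r,\tilde c)\in D:\tilde r\le r\}$ and $\mathrm{room}_D(r,c)=r-\max_{\tilde c\ge c}|\mathrm{blockers}_{D,\tilde c}(r,c)|$. -}

module Defs where

open import Data.Nat using (ℕ; zero; suc; _∸_; _⊔_; _≡ᵇ_; _≤ᵇ_; _<_; _+_)
open import Data.Bool using (Bool; true; false; _∧_; _∨_; not; if_then_else_)
open import Data.List using (List; []; _∷_; map; filter; foldr; length; deduplicate; upTo)
open import Data.Maybe using (Maybe; just; nothing)
open import Data.Product using (_×_; _,_; proj₁; proj₂)
open import Relation.Binary.PropositionalEquality using (_≡_)
open import Relation.Nullary using (¬_)
open import Data.Bool.Properties using (T?)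

-- A cell (r , c): row r, column c.
Cell : Set
Cell = ℕ × ℕ

-- A diagram is a finite set of cells, represented by a list (read as a set:
-- only membership matters).
Diagram : Set
Diagram = List Cell

_≟ᶜ_ : Cell → Cell → Bool
(a , b) ≟ᶜ (a' , b') = (a ≡ᵇ a') ∧ (b ≡ᵇ b')

mem : Cell → Diagram → Bool
mem x [] = false
mem x (y ∷ D) = (x ≟ᶜ y) ∨ mem x D

_≐_ : Diagram → Diagram → Set
D ≐ D' = ∀ x → mem x D ≡ mem x D'

rowCols : Diagram → ℕ → List ℕ
rowCols [] r = []
rowCols ((a , b) ∷ D) r = if a ≡ᵇ r then b ∷ rowCols D r else rowCols D r

maxList : List ℕ → ℕ
maxList = foldr _⊔_ 0

findGap : Diagram → ℕ → ℕ → Maybe ℕ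
findGap D c zero = nothing
findGap D c (suc n) = if mem (suc n , c) D then findGap D c n else just (suc n)

removeCell : Cell → Diagram → Diagram
removeCell x [] = []
removeCell x (y ∷ D) = if x ≟ᶜ y then removeCell x D else y ∷ removeCell x D

kohnert : Diagram → ℕ → Diagram
kohnert D r with rowCols D r
... | [] = D
... | cs@(_ ∷ _) with findGap D (maxList cs) (r ∸ 1)
...   | nothing = D
...   | just r' = (r' , maxList cs) ∷ removeCell (r , maxList cs) D

Nontrivial : Diagram → ℕ → Set
Nontrivial D r = ¬ (kohnert D r ≐ D)

Fixed : Diagram → Set
Fixed D = ∀ s → kohnert D s ≐ D

MinNontrivialRow : Diagram → ℕ → Set
MinNontrivialRow D r = Nontrivial D r × (∀ s → s < r → ¬ Nontrivial D s)

-- GreedyChain D rs : the list rs of rows is the sequence of rows r_{D_0}, r_{D_1}, …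
-- of the greedy Kohnert chain Γ(D) starting at D (each step uses the minimal row
-- with a nontrivial move; the chain stops at a diagram fixed by all moves).
data GreedyChain : Diagram → List ℕ → Set where
  stop : ∀ {D} → Fixed D → GreedyChain D []
  step : ∀ {D r rs} → MinNontrivialRow D r → GreedyChain (kohnert D r) rs →
         GreedyChain D (r ∷ rs)

colCount : Diagram → ℕ → ℕ → ℕ
colCount D c zero = 0
colCount D c (suc s) = (if mem (suc s , c) D then 1 else 0) + colCount D c s

-- The Kohnert move at row s on D moves the k-th lowest cell of column c.
movesKth : Diagram → ℕ → ℕ → ℕ → Bool
movesKth D k c s with rowCols D s
... | [] = false
... | cs@(_ ∷ _) with findGap D (maxList cs) (s ∸ 1)
...   | nothing = false
...   | just _ = (maxList cs ≡ᵇ c) ∧ (colCount D c s ≡ᵇ k)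

movedRows : Diagram → ℕ → ℕ → List ℕ → List ℕ
movedRows D k c [] = []
movedRows D k c (s ∷ rs) =
  if movesKth D k c s then s ∷ movedRows (kohnert D s) k c rs
  else movedRows (kohnert D s) k c rs

RSet : Diagram → ℕ → ℕ → List ℕ → List ℕ
RSet D0 r c rs = deduplicate Data.Nat._≟_ (movedRows D0 (colCount D0 c r) c rs)

-- |blockers_{D,c̃}(r,c)| (for diagrams with positive rows).
blockers : Diagram → ℕ → ℕ → ℕ
blockers D c̃ r = colCount D c̃ r

maxCol : Diagram → ℕ
maxCol D = maxList (map proj₂ D)

-- room_D(r,c) = r - max_{c̃ ≥ c} |blockers_{D,c̃}(r,c)|; columns c̃ > maxCol D
-- contribute 0, so it suffices to range over c̃ ∈ [c, c + maxCol D].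
room : Diagram → ℕ → ℕ → ℕ
room D r c = r ∸ maxList (map (λ i → blockers D (c + i) r) (upTo (suc (maxCol D))))

-- Follow the standard (r, c)-cell through the greedy chain. A step at row s carries the rightmost
-- cell (s, m) of row s down to the highest empty row below it in column m. By minimality every row
-- t < s admits only a trivial move, so each cell of such a row has a column weakly to its right that
-- is full up to row t, and its room is 0. Hence the tracked cell keeps its room at every step unless
-- it is the moving cell itself; then its standard successor sits in row s - 1 (column m is now full
-- from the landing row up to s - 1) and its room drops by exactly one. The chain ends at a fixed
-- diagram, where all rooms are 0, so the tracked cell is moved exactly room_{D₀}(r, c) times, from
-- strictly decreasing rows.

module Submission where

open import Defs
open import Data.Bool using (true; false; if_then_else_; _∧_; _∨_)
open import Data.Bool.Properties using (∨-zeroʳ; ∧-zeroʳ)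
open import Data.List using (List; []; _∷_; map; length; deduplicate; upTo)
open import Data.List.Membership.Propositional using (_∈_)
open import Data.List.Membership.Propositional.Properties using (∈-map⁺; ∈-map⁻; ∈-upTo⁺)
open import Data.List.Properties using (filter-all)
open import Data.List.Relation.Unary.All as All using (All; []; _∷_)
open import Data.List.Relation.Unary.AllPairs as AllPairs using (AllPairs; []; _∷_)
open import Data.List.Relation.Unary.Any using (here; there)
open import Data.List.Relation.Unary.Unique.Propositional using (Unique)
open import Data.Maybe using (just; nothing)
open import Data.Nat using (ℕ; zero; suc; pred; _∸_; _≡ᵇ_; _<_; _≤_; _>_; _+_; z≤n; s≤s; z<s; _≟_; _≤?_; >-nonZero)
open import Data.Nat.Properties
open import Data.Product using (_×_; _,_; proj₁; proj₂; ∃)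
open import Data.Sum using (_⊎_; inj₁; inj₂; [_,_]′)
open import Function using (_∘_)
open import Relation.Binary using (tri<; tri≈; tri>)
open import Relation.Binary.Definitions using (DecidableEquality)
open import Relation.Binary.PropositionalEquality
open import Relation.Nullary using (¬_; yes; no; ¬?; contradiction)
open import Relation.Nullary.Reflects using (Reflects; ofʸ; ofⁿ; fromEquivalence; det)

≤pred⇒< : ∀ {m n} → 0 < m → m ≤ pred n → m < n
≤pred⇒< {n = zero}  0<m m≤0 = contradiction (<-≤-trans 0<m m≤0) λ ()
≤pred⇒< {n = suc _} _   m≤n = s≤s m≤n

pred<self : ∀ {n} → 0 < n → pred n < n
pred<self {suc _} _ = ≤-refl

≡ᵇ-reflects : ∀ m n → Reflects (m ≡ n) (m ≡ᵇ n)
≡ᵇ-reflects m n = fromEquivalence (≡ᵇ⇒≡ m n) (≡⇒≡ᵇ m n)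

≡ᵇ-refl : ∀ n → (n ≡ᵇ n) ≡ true
≡ᵇ-refl n = det (≡ᵇ-reflects n n) (ofʸ refl)

≢⇒≡ᵇ-false : ∀ {m n} → m ≢ n → (m ≡ᵇ n) ≡ false
≢⇒≡ᵇ-false {m} {n} m≢n = det (≡ᵇ-reflects m n) (ofⁿ m≢n)

≟ᶜ-reflects : ∀ x y → Reflects (x ≡ y) (x ≟ᶜ y)
≟ᶜ-reflects (a , b) (a′ , b′) with a ≡ᵇ a′ | ≡ᵇ-reflects a a′
... | false | ofⁿ a≢a′ = ofⁿ (a≢a′ ∘ cong proj₁)
... | true  | ofʸ refl with b ≡ᵇ b′ | ≡ᵇ-reflects b b′
...   | false | ofⁿ b≢b′ = ofⁿ (b≢b′ ∘ cong proj₂)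
...   | true  | ofʸ refl = ofʸ refl

≟ᶜ-refl : ∀ x → (x ≟ᶜ x) ≡ true
≟ᶜ-refl x = det (≟ᶜ-reflects x x) (ofʸ refl)

≢⇒≟ᶜ-false : ∀ {x y} → x ≢ y → (x ≟ᶜ y) ≡ false
≢⇒≟ᶜ-false {x} {y} x≢y = det (≟ᶜ-reflects x y) (ofⁿ x≢y)

occupied≢empty : ∀ {x D} → mem x D ≡ true → mem x D ≢ false
occupied≢empty occ emp with () ← trans (sym occ) emp

mem-here : ∀ x D → mem x (x ∷ D) ≡ true
mem-here x D = cong (_∨ mem x D) (≟ᶜ-refl x)

∈⇒mem : ∀ {x D} → x ∈ D → mem x D ≡ true
∈⇒mem {x} {_ ∷ D} (here refl) = mem-here x D
∈⇒mem {x} {y ∷ _} (there x∈D) rewrite ∈⇒mem x∈D = ∨-zeroʳ (x ≟ᶜ y)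

mem⇒∈ : ∀ {x} D → mem x D ≡ true → x ∈ D
mem⇒∈ {x} (y ∷ D) occ with x ≟ᶜ y | ≟ᶜ-reflects x y
... | true  | ofʸ refl = here refl
... | false | _        = there (mem⇒∈ D occ)

mem-removeCell-self : ∀ x D → mem x (removeCell x D) ≡ false
mem-removeCell-self x [] = refl
mem-removeCell-self x (y ∷ D) with x ≟ᶜ y in x≟y
... | true  = mem-removeCell-self x D
... | false rewrite x≟y = mem-removeCell-self x D

mem-removeCell-other : ∀ {x y} D → x ≢ y → mem x (removeCell y D) ≡ mem x D
mem-removeCell-other [] _ = refl
mem-removeCell-other {x} {y} (z ∷ D) x≢y with y ≟ᶜ z | ≟ᶜ-reflects y z
... | true  | ofʸ refl rewrite ≢⇒≟ᶜ-false x≢y = mem-removeCell-other D x≢y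
... | false | _        = cong ((x ≟ᶜ z) ∨_) (mem-removeCell-other D x≢y)

maxList-upper : ∀ {x xs} → x ∈ xs → x ≤ maxList xs
maxList-upper {x} {_ ∷ xs} (here refl) = m≤m⊔n x (maxList xs)
maxList-upper {_} {y ∷ _} (there x∈xs) = ≤-trans (maxList-upper x∈xs) (m≤n⊔m y _)

maxList-∈ : ∀ x xs → maxList (x ∷ xs) ∈ x ∷ xs
maxList-∈ x [] rewrite ⊔-identityʳ x = here refl
maxList-∈ x (y ∷ xs) with ⊔-sel x (maxList (y ∷ xs))
... | inj₁ x⊔m≡x rewrite x⊔m≡x = here refl
... | inj₂ x⊔m≡m rewrite x⊔m≡m = there (maxList-∈ y xs)

∈-rowCols⁺ : ∀ {D t c} → (t , c) ∈ D → c ∈ rowCols D t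
∈-rowCols⁺ {_ ∷ _} {t} (here refl) rewrite ≡ᵇ-refl t = here refl
∈-rowCols⁺ {(a , _) ∷ _} {t} (there tc∈D) with a ≡ᵇ t
... | true  = there (∈-rowCols⁺ tc∈D)
... | false = ∈-rowCols⁺ tc∈D

∈-rowCols⁻ : ∀ {D t c} → c ∈ rowCols D t → (t , c) ∈ D
∈-rowCols⁻ {(a , _) ∷ _} {t} c∈ with a ≡ᵇ t | ≡ᵇ-reflects a t
∈-rowCols⁻ (here refl)  | true  | ofʸ refl = here refl
∈-rowCols⁻ (there c∈)   | true  | ofʸ refl = there (∈-rowCols⁻ c∈)
∈-rowCols⁻ c∈           | false | _        = there (∈-rowCols⁻ c∈)

rowMax-occupied : ∀ D t {c₀ cs} → rowCols D t ≡ c₀ ∷ cs → mem (t , maxList (c₀ ∷ cs)) D ≡ true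
rowMax-occupied D t {c₀} {cs} row≡ =
  ∈⇒mem (∈-rowCols⁻ {D} {t} (subst (maxList (c₀ ∷ cs) ∈_) (sym row≡) (maxList-∈ c₀ cs)))

≤rowMax : ∀ D {t c c₀ cs} → rowCols D t ≡ c₀ ∷ cs → mem (t , c) D ≡ true → c ≤ maxList (c₀ ∷ cs)
≤rowMax D {c = c} row≡ occ = maxList-upper (subst (c ∈_) row≡ (∈-rowCols⁺ (mem⇒∈ D occ)))

∈⇒≤maxCol : ∀ D {u c} → (u , c) ∈ D → c ≤ maxCol D
∈⇒≤maxCol D = maxList-upper ∘ ∈-map⁺ proj₂

record Full (D : Diagram) (c a b : ℕ) : Set where
  constructor full
  field filled : ∀ {u} → a < u → u ≤ b → mem (u , c) D ≡ true

open Full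

Full-empty : ∀ {D c a b} → b ≤ a → Full D c a b
Full-empty b≤a = full λ a<u u≤b → contradiction (<-≤-trans a<u u≤b) (≤⇒≯ b≤a)

Full-extend : ∀ {D c a} t → Full D c a (pred t) → mem (t , c) D ≡ true → Full D c a t
Full-extend zero    _    _   = Full-empty z≤n
Full-extend {D} {c} {a} (suc t) F occ = full filled′
  where
  filled′ : ∀ {u} → a < u → u ≤ suc t → mem (u , c) D ≡ true
  filled′ a<u u≤1+t with m≤n⇒m<n∨m≡n u≤1+t
  ... | inj₁ (s≤s u≤t) = filled F a<u u≤t
  ... | inj₂ refl      = occ

findGap-just : ∀ {D c} n {to} → findGap D c n ≡ just to →
  0 < to × to ≤ n × mem (to , c) D ≡ false × Full D c to n
findGap-just {D} {c} (suc n) found with mem (suc n , c) D in occ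
... | false with refl ← found = s≤s z≤n , ≤-refl , occ , Full-empty ≤-refl
... | true with 0<to , to≤n , gap , F ← findGap-just n found =
  0<to , m≤n⇒m≤1+n to≤n , gap , Full-extend (suc n) F occ

findGap-nothing : ∀ {D c} n → findGap D c n ≡ nothing → Full D c 0 n
findGap-nothing zero    _ = Full-empty z≤n
findGap-nothing {D} {c} (suc n) none with mem (suc n , c) D in occ
... | true  = Full-extend (suc n) (findGap-nothing n none) occ
... | false = contradiction none λ ()

colCount-cong : ∀ {D E c} t → (∀ {u} → u ≤ t → mem (u , c) D ≡ mem (u , c) E) →
  colCount D c t ≡ colCount E c t
colCount-cong zero    _    = refl
colCount-cong (suc t) same =
  cong₂ _+_ (cong (if_then 1 else 0) (same ≤-refl)) (colCount-cong t (same ∘ m≤n⇒m≤1+n))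

colCount-occupied : ∀ D c {t} → 0 < t → mem (t , c) D ≡ true →
  colCount D c t ≡ suc (colCount D c (pred t))
colCount-occupied D c {suc _} _ occ rewrite occ = refl

colCount-empty : ∀ {D c} t → mem (t , c) D ≡ false → colCount D c t ≡ colCount D c (pred t)
colCount-empty zero    _   = refl
colCount-empty (suc t) emp rewrite emp = refl

colCount-≤ : ∀ D c t → colCount D c t ≤ t
colCount-≤ D c zero    = z≤n
colCount-≤ D c (suc t) with mem (suc t , c) D
... | true  = s≤s (colCount-≤ D c t)
... | false = m≤n⇒m≤1+n (colCount-≤ D c t)

colCount-full : ∀ {D c} t → Full D c 0 t → colCount D c t ≡ t
colCount-full zero    _    = refl
colCount-full {D} {c} (suc t) F = trans (colCount-occupied D c z<s (filled F z<s ≤-refl))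
  (cong suc (colCount-full t (full λ 0<u → filled F 0<u ∘ m≤n⇒m≤1+n)))

colCount-gap : ∀ {D c u} t → 0 < u → u ≤ t → mem (u , c) D ≡ false → colCount D c t < t
colCount-gap zero 0<u u≤0 _ = contradiction (<-≤-trans 0<u u≤0) λ ()
colCount-gap {D} {c} (suc t) 0<u u≤1+t emp with m≤n⇒m<n∨m≡n u≤1+t
... | inj₂ refl rewrite emp = s≤s (colCount-≤ D c t)
... | inj₁ (s≤s u≤t) with mem (suc t , c) D
...   | true  = s≤s (colCount-gap t 0<u u≤t emp)
...   | false = m≤n⇒m≤1+n (colCount-gap t 0<u u≤t emp)

colCount-mono : ∀ {D c a} b → a ≤ b → colCount D c a ≤ colCount D c b
colCount-mono {D} {c} b a≤b with m≤n⇒m<n∨m≡n a≤b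
... | inj₂ refl = ≤-refl
colCount-mono {D} {c} (suc b) _ | inj₁ (s≤s a≤b) with mem (suc b , c) D
...   | true  = m≤n⇒m≤1+n (colCount-mono b a≤b)
...   | false = colCount-mono b a≤b

colCount-occupied-< : ∀ {D c a b} → mem (b , c) D ≡ true → a < b → colCount D c a < colCount D c b
colCount-occupied-< {b = suc b} occ (s≤s a≤b) rewrite occ = s≤s (colCount-mono b a≤b)

colCount-injective : ∀ {D c a b} → mem (a , c) D ≡ true → mem (b , c) D ≡ true →
  colCount D c a ≡ colCount D c b → a ≡ b
colCount-injective occa occb same with <-cmp _ _
... | tri< a<b _ _ = contradiction same (<⇒≢ (colCount-occupied-< occb a<b))
... | tri≈ _ a≡b _ = a≡b
... | tri> _ _ b<a = contradiction same (>⇒≢ (colCount-occupied-< occa b<a))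

colCount-beyond : ∀ {D c} t → maxCol D < c → colCount D c t ≡ 0
colCount-beyond zero _ = refl
colCount-beyond {D} {c} (suc t) max<c with mem (suc t , c) D in occ
... | true  = contradiction (∈⇒≤maxCol D (mem⇒∈ D occ)) (<⇒≱ max<c)
... | false = colCount-beyond t max<c

maxBlockers : Diagram → (r c : ℕ) → ℕ
maxBlockers D r c = maxList (map (λ i → blockers D (c + i) r) (upTo (suc (maxCol D))))

blockers≤maxBlockers : ∀ D r {c c̃} → c ≤ c̃ → blockers D c̃ r ≤ maxBlockers D r c
blockers≤maxBlockers D r {c} {c̃} c≤c̃ with c̃ ≤? c + maxCol D
... | yes c̃≤ =
  subst (λ col → blockers D col r ≤ maxBlockers D r c) (m+[n∸m]≡n c≤c̃)
    (maxList-upper (∈-map⁺ (λ i → blockers D (c + i) r) offset∈))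
  where
  offset≤ : c̃ ∸ c ≤ maxCol D
  offset≤ = subst (c̃ ∸ c ≤_) (m+n∸m≡n c (maxCol D)) (∸-monoˡ-≤ c c̃≤)
  offset∈ : c̃ ∸ c ∈ upTo (suc (maxCol D))
  offset∈ = ∈-upTo⁺ (s≤s offset≤)
... | no c̃≰ = ≤-trans (≤-reflexive (colCount-beyond r (≤-<-trans (m≤n+m _ c) (≰⇒> c̃≰)))) z≤n

maxBlockers-attained : ∀ D r c → ∃ λ c̃ → c ≤ c̃ × maxBlockers D r c ≡ blockers D c̃ r
maxBlockers-attained D r c =
  let i , _ , max≡ = ∈-map⁻ (λ i → blockers D (c + i) r) max∈ in c + i , m≤m+n c i , max≡
  where
  max∈ : maxBlockers D r c ∈ map (λ i → blockers D (c + i) r) (upTo (suc (maxCol D)))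
  max∈ = maxList-∈ _ _

maxBlockers-cong : ∀ {D E r t c} → (∀ {c̃} → c ≤ c̃ → blockers E c̃ t ≡ blockers D c̃ r) →
  maxBlockers E t c ≡ maxBlockers D r c
maxBlockers-cong {D} {E} {r} {t} {c} same
  with maxBlockers-attained D r c | maxBlockers-attained E t c
... | c₁ , c≤c₁ , maxD≡ | c₂ , c≤c₂ , maxE≡ = ≤-antisym
  (subst (_≤ maxBlockers D r c) (sym (trans maxE≡ (same c≤c₂))) (blockers≤maxBlockers D r c≤c₂))
  (subst (_≤ maxBlockers E t c) (sym (trans maxD≡ (sym (same c≤c₁)))) (blockers≤maxBlockers E t c≤c₁))

Blocked : Diagram → (t c : ℕ) → Set
Blocked D t c = ∃ λ c̃ → c ≤ c̃ × Full D c̃ 0 t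

room-blocked : ∀ {D t c} → Blocked D t c → room D t c ≡ 0
room-blocked {D} {t} {c} (c̃ , c≤c̃ , F) =
  m≤n⇒m∸n≡0 (subst (_≤ maxBlockers D t c) (colCount-full t F) (blockers≤maxBlockers D t c≤c̃))

-- If the rightmost cell of row t cannot move, its column is full up to row t.
trivial⇒Blocked : ∀ {D t c} → ¬ Nontrivial D t → mem (t , c) D ≡ true → Blocked D t c
trivial⇒Blocked {D} {t} {c} trivial occ with rowCols D t in row≡
... | [] with () ← subst (c ∈_) row≡ (∈-rowCols⁺ (mem⇒∈ D occ))
... | c₀ ∷ cs with findGap D (maxList (c₀ ∷ cs)) (pred t) in gap≡
...   | just to with _ , _ , gap , _ ← findGap-just (pred t) gap≡ =
  contradiction (λ same → occupied≢empty {D = D} (trans (sym (same landing)) (mem-here landing rest)) gap) trivial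
  where
  landing = to , maxList (c₀ ∷ cs)
  rest = removeCell (t , maxList (c₀ ∷ cs)) D
...   | nothing = maxList (c₀ ∷ cs) , ≤rowMax D row≡ occ ,
  Full-extend t (findGap-nothing (pred t) gap≡) (rowMax-occupied D t row≡)

kohnert-just : ∀ D s {c₀ cs to} → rowCols D s ≡ c₀ ∷ cs →
  findGap D (maxList (c₀ ∷ cs)) (pred s) ≡ just to →
  kohnert D s ≡ (to , maxList (c₀ ∷ cs)) ∷ removeCell (s , maxList (c₀ ∷ cs)) D ×
  (∀ k c → movesKth D k c s ≡ (maxList (c₀ ∷ cs) ≡ᵇ c) ∧ (colCount D c s ≡ᵇ k))
kohnert-just D s {c₀} {cs} row≡ gap≡ with rowCols D s | row≡
... | _ | refl with findGap D (maxList (c₀ ∷ cs)) (pred s) | gap≡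
...   | _ | refl = refl , λ _ _ → refl

record Move (D : Diagram) (s : ℕ) : Set where
  field
    col to    : ℕ
    occupied  : mem (s , col) D ≡ true
    rightmost : ∀ {c} → col < c → mem (s , c) D ≡ false
    0<to      : 0 < to
    to<s      : to < s
    gap       : mem (to , col) D ≡ false
    between   : Full D col to (pred s)
    kohnert≡  : kohnert D s ≡ (to , col) ∷ removeCell (s , col) D
    movesKth≡ : ∀ k c → movesKth D k c s ≡ (col ≡ᵇ c) ∧ (colCount D c s ≡ᵇ k)

nontrivial⇒Move : ∀ {D s} → Nontrivial D s → Move D s
nontrivial⇒Move {D} {s} nontrivial with rowCols D s in row≡
... | [] = contradiction (λ _ → refl) nontrivial
... | c₀ ∷ cs with findGap D (maxList (c₀ ∷ cs)) (pred s) in gap≡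
...   | nothing = contradiction (λ _ → refl) nontrivial
...   | just to with 0<to , to≤ , gap , between ← findGap-just (pred s) gap≡ = record
  { col = maxList (c₀ ∷ cs) ; to = to
  ; occupied = rowMax-occupied D s row≡
  ; rightmost = rightmost
  ; 0<to = 0<to ; to<s = ≤pred⇒< 0<to to≤ ; gap = gap ; between = between
  ; kohnert≡ = proj₁ (kohnert-just D s row≡ gap≡) ; movesKth≡ = proj₂ (kohnert-just D s row≡ gap≡) }
  where
  rightmost : ∀ {c} → maxList (c₀ ∷ cs) < c → mem (s , c) D ≡ false
  rightmost {c} max<c with mem (s , c) D in occ
  ... | false = refl
  ... | true  = contradiction (≤rowMax D row≡ occ) (<⇒≱ max<c)

data Fate (D : Diagram) (s r c row : ℕ) : Set where
  moved  : movesKth D (colCount D c r) c s ≡ true → r ≡ s → suc row ≡ r →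
           room D r c ≡ suc (room (kohnert D s) row c) → Fate D s r c row
  stayed : movesKth D (colCount D c r) c s ≡ false → row ≤ r →
           room (kohnert D s) row c ≡ room D r c → Fate D s r c row

-- The standard r-cell in column c of kohnert D s is the cell of column c with the same rank.
record StandardCellAfter (D : Diagram) (s r c : ℕ) : Set where
  field
    row      : ℕ
    occupied : mem (row , c) (kohnert D s) ≡ true
    rank     : colCount (kohnert D s) c row ≡ colCount D c r
    fate     : Fate D s r c row

module AfterMove {D : Diagram} {s : ℕ} (mv : Move D s) where
  open Move mv

  K : Diagram
  K = kohnert D s

  0<s : 0 < s
  0<s = <-trans 0<to to<s

  mem-K-to : mem (to , col) K ≡ true
  mem-K-to = trans (cong (mem (to , col)) kohnert≡) (mem-here (to , col) (removeCell (s , col) D))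

  mem-K-s : mem (s , col) K ≡ false
  mem-K-s = trans (cong (mem (s , col)) kohnert≡)
    (cong₂ _∨_ (≢⇒≟ᶜ-false {s , col} ((>⇒≢ to<s) ∘ cong proj₁)) (mem-removeCell-self (s , col) D))

  mem-K-other : ∀ {x} → x ≢ (to , col) → x ≢ (s , col) → mem x K ≡ mem x D
  mem-K-other {x} x≢to x≢s = trans (cong (mem x) kohnert≡)
    (cong₂ _∨_ (≢⇒≟ᶜ-false x≢to) (mem-removeCell-other D x≢s))

  mem-K-otherRow : ∀ {u c} → u ≢ to → u ≢ s → mem (u , c) K ≡ mem (u , c) D
  mem-K-otherRow u≢to u≢s = mem-K-other (u≢to ∘ cong proj₁) (u≢s ∘ cong proj₁)

  mem-K-otherCol : ∀ {u c} → c ≢ col → mem (u , c) K ≡ mem (u , c) D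
  mem-K-otherCol c≢col = mem-K-other (c≢col ∘ cong proj₂) (c≢col ∘ cong proj₂)

  mem-K-between : ∀ {t} → to ≤ t → t < s → mem (t , col) K ≡ true
  mem-K-between to≤t t<s with m≤n⇒m<n∨m≡n to≤t
  ... | inj₂ refl = mem-K-to
  ... | inj₁ to<t = trans (mem-K-otherRow (>⇒≢ to<t) (<⇒≢ t<s)) (filled between to<t (<⇒≤pred t<s))

  colCount-K-other : ∀ {c} → c ≢ col → ∀ t → colCount K c t ≡ colCount D c t
  colCount-K-other c≢col t = colCount-cong t λ _ → mem-K-otherCol c≢col

  colCount-K-below : ∀ {t} → t < to → colCount K col t ≡ colCount D col t
  colCount-K-below {t} t<to = colCount-cong t λ u≤t →
    mem-K-otherRow (<⇒≢ (≤-<-trans u≤t t<to)) (<⇒≢ (≤-<-trans u≤t (<-trans t<to to<s)))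

  colCount-K-between : ∀ {t} → to ≤ t → t < s → colCount K col t ≡ suc (colCount D col t)
  colCount-K-between {zero} to≤0 _ = contradiction (<-≤-trans 0<to to≤0) λ ()
  colCount-K-between {suc t} to≤1+t 1+t<s with m≤n⇒m<n∨m≡n to≤1+t
  ... | inj₂ refl = begin
    colCount K col (suc t)      ≡⟨ colCount-occupied K col z<s mem-K-to ⟩
    suc (colCount K col t)      ≡⟨ cong suc (colCount-K-below ≤-refl) ⟩
    suc (colCount D col t)      ≡⟨ cong suc (colCount-empty (suc t) gap) ⟨
    suc (colCount D col (suc t)) ∎
    where open ≡-Reasoning
  ... | inj₁ (s≤s to≤t) = begin
    colCount K col (suc t)       ≡⟨ colCount-occupied K col z<s (mem-K-between to≤1+t 1+t<s) ⟩
    suc (colCount K col t)       ≡⟨ cong suc (colCount-K-between to≤t (<-trans (n<1+n t) 1+t<s)) ⟩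
    suc (suc (colCount D col t)) ≡⟨ cong suc (colCount-occupied D col z<s occupied-1+t) ⟨
    suc (colCount D col (suc t)) ∎
    where
    open ≡-Reasoning
    occupied-1+t = filled between (s≤s to≤t) (<⇒≤pred 1+t<s)

  colCount-K-above : ∀ {t} → s ≤ t → colCount K col t ≡ colCount D col t
  colCount-K-above {zero} s≤0 = contradiction (<-≤-trans 0<s s≤0) λ ()
  colCount-K-above {suc t} s≤1+t with m≤n⇒m<n∨m≡n s≤1+t
  ... | inj₂ refl = begin
    colCount K col (suc t)       ≡⟨ colCount-empty (suc t) mem-K-s ⟩
    colCount K col t             ≡⟨ colCount-K-between (<⇒≤pred to<s) (n<1+n t) ⟩
    suc (colCount D col t)       ≡⟨ colCount-occupied D col z<s occupied ⟨
    colCount D col (suc t)       ∎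
    where open ≡-Reasoning
  ... | inj₁ (s≤s s≤t) = cong₂ _+_
    (cong (if_then 1 else 0) (mem-K-otherRow (>⇒≢ (<-≤-trans to<s (m≤n⇒m≤1+n s≤t))) (>⇒≢ (s≤s s≤t))))
    (colCount-K-above s≤t)

  colCount-K-unchanged : ∀ {t} → t < to ⊎ s ≤ t → ∀ c → colCount K c t ≡ colCount D c t
  colCount-K-unchanged {t} outside c with c ≟ col
  ... | no c≢col = colCount-K-other c≢col t
  ... | yes refl = [ colCount-K-below , colCount-K-above ]′ outside

  room-K-unchanged : ∀ {t} → t < to ⊎ s ≤ t → ∀ c → room K t c ≡ room D t c
  room-K-unchanged {t} outside c =
    cong (t ∸_) (maxBlockers-cong {D} {K} {t} {t} λ {c̃} _ → colCount-K-unchanged outside c̃)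

  Blocked-K : ∀ {t c t′} → Blocked D t c → to ≤ t → t′ ≤ t → Blocked K t′ c
  Blocked-K (c̃ , c≤c̃ , F) to≤t t′≤t = c̃ , c≤c̃ , full λ 0<u u≤t′ →
    trans (mem-K-otherCol c̃≢col) (filled F 0<u (≤-trans u≤t′ t′≤t))
    where
    c̃≢col : c̃ ≢ col
    c̃≢col refl = occupied≢empty {D = D} (filled F 0<to to≤t) gap

  movesKth-self : movesKth D (colCount D col s) col s ≡ true
  movesKth-self = trans (movesKth≡ _ col) (cong₂ _∧_ (≡ᵇ-refl col) (≡ᵇ-refl (colCount D col s)))

  movesKth-other : ∀ {r c} → mem (r , c) D ≡ true → (r , c) ≢ (s , col) →
    movesKth D (colCount D c r) c s ≡ false
  movesKth-other {r} {c} occ rc≢s with col ≟ c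
  ... | no col≢c =
    trans (movesKth≡ _ c) (cong (_∧ (colCount D c s ≡ᵇ colCount D c r)) (≢⇒≡ᵇ-false col≢c))
  ... | yes refl =
    trans (movesKth≡ _ col) (trans (cong ((col ≡ᵇ col) ∧_) (≢⇒≡ᵇ-false different-rank)) (∧-zeroʳ _))
    where
    different-rank : colCount D col s ≢ colCount D col r
    different-rank same = rc≢s (cong (_, col) (colCount-injective occ occupied (sym same)))

  colCount-K-away : ∀ {r c} → c ≢ col ⊎ r < to ⊎ s < r → colCount K c r ≡ colCount D c r
  colCount-K-away {r} (inj₁ c≢col)         = colCount-K-other c≢col r
  colCount-K-away {c = c} (inj₂ (inj₁ r<to)) = colCount-K-unchanged (inj₁ r<to) c
  colCount-K-away {c = c} (inj₂ (inj₂ s<r))  = colCount-K-unchanged (inj₂ (<⇒≤ s<r)) c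

  mem-K-pred : ∀ {r} → to < r → r ≤ s → mem (pred r , col) K ≡ true
  mem-K-pred to<r r≤s = mem-K-between (<⇒≤pred to<r) (<-≤-trans (pred<self (<-trans 0<to to<r)) r≤s)

  colCount-K-pred : ∀ {r} → mem (r , col) D ≡ true → to < r → r ≤ s → colCount K col (pred r) ≡ colCount D col r
  colCount-K-pred occ to<r r≤s = trans
    (colCount-K-between (<⇒≤pred to<r) (<-≤-trans (pred<self 0<r) r≤s))
    (sym (colCount-occupied D col 0<r occ))
    where
    0<r = <-trans 0<to to<r

  maxBlockers-D<s : maxBlockers D s col < s
  maxBlockers-D<s with maxBlockers-attained D s col
  ... | c̃ , col≤c̃ , max≡ with c̃ ≟ col
  ...   | yes refl  = subst (_< s) (sym max≡) (colCount-gap s 0<to (<⇒≤ to<s) gap)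
  ...   | no c̃≢col = subst (_< s) (sym max≡) (colCount-gap s 0<s ≤-refl (rightmost (≤∧≢⇒< col≤c̃ (c̃≢col ∘ sym))))

  maxBlockers-K≡ : maxBlockers K (pred s) col ≡ maxBlockers D s col
  maxBlockers-K≡ = maxBlockers-cong {D} {K} {s} {pred s} same
    where
    same : ∀ {c̃} → col ≤ c̃ → colCount K c̃ (pred s) ≡ colCount D c̃ s
    same {c̃} col≤c̃ with c̃ ≟ col
    ... | yes refl  = colCount-K-pred occupied to<s ≤-refl
    ... | no c̃≢col = trans (colCount-K-other c̃≢col (pred s))
                           (sym (colCount-empty s (rightmost (≤∧≢⇒< col≤c̃ (c̃≢col ∘ sym)))))

  room-drops : room D s col ≡ suc (room K (pred s) col)
  room-drops = begin
    s ∸ M                     ≡⟨ cong (_∸ M) (suc-pred s ⦃ >-nonZero 0<s ⦄) ⟨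
    suc (pred s) ∸ M          ≡⟨ +-∸-assoc 1 (<⇒≤pred maxBlockers-D<s) ⟩
    suc (pred s ∸ M)          ≡⟨ cong (λ M′ → suc (pred s ∸ M′)) maxBlockers-K≡ ⟨
    suc (room K (pred s) col) ∎
    where
    open ≡-Reasoning
    M = maxBlockers D s col

  away⇒≢s : ∀ {r c} → c ≢ col ⊎ r < to ⊎ s < r → (r , c) ≢ (s , col)
  away⇒≢s (inj₁ c≢col)       = c≢col ∘ cong proj₂
  away⇒≢s (inj₂ (inj₁ r<to)) = <⇒≢ (<-trans r<to to<s) ∘ cong proj₁
  away⇒≢s (inj₂ (inj₂ s<r))  = >⇒≢ s<r ∘ cong proj₁

  module _ (minimal : ∀ t → t < s → ¬ Nontrivial D t) where

    -- Rows below s admit only trivial moves, so their cells have room 0, before and after the move.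
    room-K-below-s : ∀ {r c t} → mem (r , c) D ≡ true → to ≤ r → r < s → t ≤ r → room K t c ≡ room D r c
    room-K-below-s occ to≤r r<s t≤r =
      trans (room-blocked (Blocked-K blocked to≤r t≤r)) (sym (room-blocked blocked))
      where
      blocked = trivial⇒Blocked (minimal _ r<s) occ

    room-K-same-row : ∀ {r c} → mem (r , c) D ≡ true → room K r c ≡ room D r c
    room-K-same-row {r} {c} occ with r <? to | s ≤? r
    ... | yes r<to | _       = room-K-unchanged (inj₁ r<to) c
    ... | no _     | yes s≤r = room-K-unchanged (inj₂ s≤r) c
    ... | no r≮to  | no s≰r  = room-K-below-s occ (≮⇒≥ r≮to) (≰⇒> s≰r) ≤-refl

    stays : ∀ {r c} → mem (r , c) D ≡ true → c ≢ col ⊎ r < to ⊎ s < r → StandardCellAfter D s r c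
    stays {r} {c} occ away = record
      { row      = r
      ; occupied = trans (mem-K-other (λ { refl → occupied≢empty {D = D} occ gap }) rc≢s) occ
      ; rank     = colCount-K-away away
      ; fate     = stayed (movesKth-other occ rc≢s) ≤-refl (room-K-same-row occ) }
      where
      rc≢s = away⇒≢s away

    shifts : ∀ {r} → mem (r , col) D ≡ true → to < r → r < s → StandardCellAfter D s r col
    shifts {r} occ to<r r<s = record
      { row      = pred r
      ; occupied = mem-K-pred to<r (<⇒≤ r<s)
      ; rank     = colCount-K-pred occ to<r (<⇒≤ r<s)
      ; fate     = stayed (movesKth-other occ ((<⇒≢ r<s) ∘ cong proj₁)) pred[n]≤n
                          (room-K-below-s occ (<⇒≤ to<r) r<s pred[n]≤n) }

    moves : StandardCellAfter D s s col
    moves = record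
      { row      = pred s
      ; occupied = mem-K-pred to<s ≤-refl
      ; rank     = colCount-K-pred occupied to<s ≤-refl
      ; fate     = moved movesKth-self refl (suc-pred s ⦃ >-nonZero 0<s ⦄) room-drops }

    standardCellAfter : ∀ {r c} → mem (r , c) D ≡ true → StandardCellAfter D s r c
    standardCellAfter {r} {c} occ with c ≟ col
    ... | no c≢col = stays occ (inj₁ c≢col)
    ... | yes refl with <-cmp r to
    ...   | tri< r<to _ _ = stays occ (inj₂ (inj₁ r<to))
    ...   | tri≈ _ refl _ = contradiction gap (occupied≢empty {D = D} occ)
    ...   | tri> _ _ to<r with <-cmp r s
    ...     | tri< r<s _ _ = shifts occ to<r r<s
    ...     | tri≈ _ refl _ = moves
    ...     | tri> _ _ s<r = stays occ (inj₂ (inj₂ s<r))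

record Descending (r n : ℕ) (ys : List ℕ) : Set where
  field
    length≡ : length ys ≡ n
    bounded : All (_≤ r) ys
    strict  : AllPairs _>_ ys

Descending-weaken : ∀ {r r′ n ys} → r ≤ r′ → Descending r n ys → Descending r′ n ys
Descending-weaken r≤r′ d = record
  { length≡ = length≡ ; bounded = All.map (λ y≤r → ≤-trans y≤r r≤r′) bounded ; strict = strict }
  where open Descending d

Descending-∷ : ∀ {p n ys} → Descending p n ys → Descending (suc p) (suc n) (suc p ∷ ys)
Descending-∷ d = record
  { length≡ = cong suc length≡
  ; bounded = ≤-refl ∷ All.map m≤n⇒m≤1+n bounded
  ; strict  = All.map s≤s bounded ∷ strict }
  where open Descending d

movedRows-moves : ∀ {D k c s rs} → movesKth D k c s ≡ true →
  movedRows D k c (s ∷ rs) ≡ s ∷ movedRows (kohnert D s) k c rs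
movedRows-moves moves rewrite moves = refl

movedRows-stays : ∀ {D k c s rs} → movesKth D k c s ≡ false →
  movedRows D k c (s ∷ rs) ≡ movedRows (kohnert D s) k c rs
movedRows-stays stays rewrite stays = refl

movedRows-descending : ∀ {D rs} → GreedyChain D rs → ∀ {r c} → mem (r , c) D ≡ true →
  Descending r (room D r c) (movedRows D (colCount D c r) c rs)
movedRows-descending {D} (stop fixed) {r} {c} occ = record
  { length≡ = sym (room-blocked (trivial⇒Blocked {D} {r} {c} (λ nontrivial → nontrivial (fixed r)) occ))
  ; bounded = []
  ; strict  = [] }
movedRows-descending (step {D} {s} {rs} (nontrivial , minimal) chain) {r} {c} occ
  with AfterMove.standardCellAfter (nontrivial⇒Move nontrivial) minimal {r} {c} occ
... | record { row = p ; occupied = occ′ ; rank = rank ; fate = fate }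
  with subst (λ k → Descending p (room (kohnert D s) p c) (movedRows (kohnert D s) k c rs))
             rank (movedRows-descending chain occ′)
     | fate
... | tail | moved moves refl refl room≡ =
  subst₂ (Descending r) (sym room≡) (sym (movedRows-moves {D} {rs = rs} moves)) (Descending-∷ tail)
... | tail | stayed stays p≤r room≡ =
  subst₂ (Descending r) room≡ (sym (movedRows-stays {D} {rs = rs} stays)) (Descending-weaken p≤r tail)

deduplicate-unique : ∀ {a} {A : Set a} (_≟_ : DecidableEquality A) {xs} → Unique xs →
  deduplicate _≟_ xs ≡ xs
deduplicate-unique _≟_ [] = refl
deduplicate-unique _≟_ {x ∷ _} (x∉xs ∷ unique) rewrite deduplicate-unique _≟_ unique =
  cong (x ∷_) (filter-all (¬? ∘ (x ≟_)) x∉xs)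

proposition3p4 : (D₀ : Diagram) → All (λ x → (0 < proj₁ x) × (0 < proj₂ x)) D₀ →
    (r c : ℕ) → (r , c) ∈ D₀ → (rs : List ℕ) → GreedyChain D₀ rs →
    length (RSet D₀ r c rs) ≡ room D₀ r c
proposition3p4 D₀ _ r c rc∈D₀ rs chain = begin
  length (deduplicate _≟_ ys) ≡⟨ cong length (deduplicate-unique _≟_ (AllPairs.map >⇒≢ strict)) ⟩
  length ys                   ≡⟨ length≡ ⟩
  room D₀ r c                 ∎
  where
  open ≡-Reasoning
  ys = movedRows D₀ (colCount D₀ c r) c rs
  open Descending (movedRows-descending chain (∈⇒mem rc∈D₀))
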